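{- Let $(F_n)_{n\in\mathbb{Z}}$ be the Fibonacci numbers and let $(G_n)_{n\in\mathbb{Z}}$ be a Fibonacci-like sequence. Then for all integers $a$, $b$, $m$ and $n$, \[ F_{a-b}\,G_{n+m}=F_{m-b}\,G_{n+a}+(-1)^{a+b+1}F_{m-a}\,G_{n+b}. \]
   Context: The Fibonacci numbers are defined by $F_0=0$, $F_1=1$, $F_n=F_{n-1}+F_{n-2}$ for $n\ge 2$, and $F_{ -n}=(-1)^{n-1}F_n$. A Fibonacci-like sequence $(G_n)_{n\in\mathbb{Z}}$ is defined by arbitrary integers $G_0,G_1$, not both zero, with $G_n=G_{n-1}+G_{n-2}$ for $n\ge 2$, extended to negative indices by $G_{ -n}=G_{ -n+2}-G_{ -n+1}$ (so $G_n=G_{n-1}+G_{n-2}$ holds for all integers $n$). -}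

module Defs where

open import Data.Nat as ℕ using (ℕ; zero; suc)
open import Data.Integer using (ℤ; +_; -[1+_]; _+_; _-_; -_; _*_)
open import Data.Product using (_×_; _,_; proj₁; proj₂)

fibℕ : ℕ → ℤ
fibℕ zero = + 0
fibℕ (suc zero) = + 1
fibℕ (suc (suc n)) = fibℕ (suc n) + fibℕ n

signℕ : ℕ → ℤ
signℕ zero = + 1
signℕ (suc k) = - signℕ k

-- (-1)^z for integer z (well defined since (-1)^{-k} = (-1)^k)
signℤ : ℤ → ℤ
signℤ (+ k) = signℕ k
signℤ -[1+ k ] = signℕ (suc k)

-- Fibonacci numbers on ℤ: F_{-n} = (-1)^{n-1} F_n
fib : ℤ → ℤ
fib (+ n) = fibℕ n
fib -[1+ k ] = signℕ k * fibℕ (suc k)   -- n = k+1, so (-1)^{n-1} = (-1)^k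

-- Fibonacci-like sequence with initial values G₀ = g0, G₁ = g1.
-- Forward: pair (Gₙ, Gₙ₊₁).
Gpos : ℤ → ℤ → ℕ → ℤ × ℤ
Gpos g0 g1 zero = g0 , g1
Gpos g0 g1 (suc n) = let p = Gpos g0 g1 n in proj₂ p , proj₁ p + proj₂ p

-- Backward: pair (G_{-n}, G_{-n+1}), using G_{-n} = G_{-n+2} - G_{-n+1}.
Gneg : ℤ → ℤ → ℕ → ℤ × ℤ
Gneg g0 g1 zero = g0 , g1
Gneg g0 g1 (suc n) = let p = Gneg g0 g1 n in proj₂ p - proj₁ p , proj₁ p

Gseq : ℤ → ℤ → ℤ → ℤ
Gseq g0 g1 (+ n) = proj₁ (Gpos g0 g1 n)
Gseq g0 g1 -[1+ k ] = proj₁ (Gneg g0 g1 (suc k))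

-- A sequence satisfying the Fibonacci recurrence on all of ℤ is determined by two
-- consecutive values, and such sequences are closed under translation and linear
-- combination. Hence, for fixed a, b, n, both sides of the identity are solutions in m,
-- and it suffices to compare them at m = b and m = b + 1. At m = b this is the
-- reflection law F₋ₓ = (-1)^(x+1) Fₓ; at m = b + 1 it is the expansion
-- G_{k+x} = Fₓ G_{k+1} + F_{x-1} G_k, which is proved by the same uniqueness argument.
module Submission where

open import Defs
open import Data.Nat using (zero; suc)
open import Data.Integer using (ℤ; +_; -[1+_]; 0ℤ; 1ℤ; -1ℤ; _+_; _-_; -_; _*_; pred)
  renaming (suc to sucℤ)
open import Data.Integer.Properties
  using ( +-comm; +-assoc; +-identityˡ; +-identityʳ; +-inverseʳ; *-assoc; *-identityˡ
        ; *-identityʳ; *-distribˡ-+; *-distribʳ-+; neg-involutive; neg-injective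
        ; neg-distribˡ-*; neg-distribʳ-*; suc-pred; +-0-abelianGroup
        ; +-commutativeSemigroup )
open import Data.Integer.Tactic.RingSolver using (solve-∀)
open import Algebra.Properties.AbelianGroup +-0-abelianGroup
  using (∙-cancelˡ; ⁻¹-anti-homo‿-)
open import Algebra.Properties.CommutativeSemigroup +-commutativeSemigroup
  using (interchange)
open import Data.Product using (_×_; _,_; proj₁; proj₂)
open import Function using (_∘_)
open import Level using (Level)
open import Relation.Binary.PropositionalEquality
  using (_≡_; refl; sym; trans; cong; cong₂; subst; module ≡-Reasoning)
open import Relation.Nullary using (¬_)
open ≡-Reasoning

private
  variable
    ℓ : Level
    S T : ℤ → ℤ

ℤ-induction : (P : ℤ → Set ℓ) → P 0ℤ → (∀ v → P v → P (sucℤ v)) →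
              (∀ v → P (sucℤ v) → P v) → ∀ v → P v
ℤ-induction P p₀ up down (+ zero)     = p₀
ℤ-induction P p₀ up down (+ suc n)    = up (+ n) (ℤ-induction P p₀ up down (+ n))
ℤ-induction P p₀ up down -[1+ zero ]  = down -[1+ zero ] p₀
ℤ-induction P p₀ up down -[1+ suc n ] = down -[1+ suc n ] (ℤ-induction P p₀ up down -[1+ n ])

+-suc : ∀ i j → i + sucℤ j ≡ sucℤ (i + j)
+-suc i j = begin
  i + (1ℤ + j)  ≡⟨ +-assoc i 1ℤ j ⟨
  i + 1ℤ + j    ≡⟨ cong (_+ j) (+-comm i 1ℤ) ⟩
  1ℤ + i + j    ≡⟨ +-assoc 1ℤ i j ⟩
  1ℤ + (i + j)  ∎

record Recurrent (S : ℤ → ℤ) : Set where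
  constructor recurrent
  field
    unfold : ∀ k → S (sucℤ (sucℤ k)) ≡ S (sucℤ k) + S k

recurrent-agree₀ : Recurrent S → Recurrent T → S 0ℤ ≡ T 0ℤ → S 1ℤ ≡ T 1ℤ → ∀ x → S x ≡ T x
recurrent-agree₀ {S} {T} (recurrent recS) (recurrent recT) e₀ e₁ x =
  proj₁ (ℤ-induction Agree (e₀ , e₁) forward backward x)
  where
  Agree : ℤ → Set
  Agree v = S v ≡ T v × S (sucℤ v) ≡ T (sucℤ v)

  forward : ∀ v → Agree v → Agree (sucℤ v)
  forward v (e , e′) = e′ , (begin
    S (sucℤ (sucℤ v))       ≡⟨ recS v ⟩
    S (sucℤ v) + S v        ≡⟨ cong₂ _+_ e′ e ⟩
    T (sucℤ v) + T v        ≡⟨ recT v ⟨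
    T (sucℤ (sucℤ v))       ∎)

  backward : ∀ v → Agree (sucℤ v) → Agree v
  backward v (e′ , e″) = ∙-cancelˡ (S (sucℤ v)) (S v) (T v) (begin
    S (sucℤ v) + S v        ≡⟨ recS v ⟨
    S (sucℤ (sucℤ v))       ≡⟨ e″ ⟩
    T (sucℤ (sucℤ v))       ≡⟨ recT v ⟩
    T (sucℤ v) + T v        ≡⟨ cong (_+ T v) e′ ⟨
    S (sucℤ v) + T v        ∎) , e′

recurrent-∘ : ∀ {f : ℤ → ℤ} → Recurrent S → (∀ x → f (sucℤ x) ≡ sucℤ (f x)) → Recurrent (S ∘ f)
recurrent-∘ {S} {f} (recurrent recS) f-suc = recurrent λ k → begin
  S (f (sucℤ (sucℤ k)))     ≡⟨ cong S (trans (f-suc (sucℤ k)) (cong sucℤ (f-suc k))) ⟩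
  S (sucℤ (sucℤ (f k)))     ≡⟨ recS (f k) ⟩
  S (sucℤ (f k)) + S (f k)  ≡⟨ cong (λ y → S y + S (f k)) (f-suc k) ⟨
  S (f (sucℤ k)) + S (f k)  ∎

recurrent-translateˡ : ∀ c → Recurrent S → Recurrent (λ x → S (c + x))
recurrent-translateˡ c recS = recurrent-∘ {f = λ x → c + x} recS (+-suc c)

recurrent-translateʳ : ∀ c → Recurrent S → Recurrent (λ x → S (x + c))
recurrent-translateʳ c recS = recurrent-∘ {f = λ x → x + c} recS (λ x → +-assoc 1ℤ x c)

recurrent-*ˡ : ∀ c → Recurrent S → Recurrent (λ x → c * S x)
recurrent-*ˡ {S} c (recurrent recS) = recurrent λ k →
  trans (cong (c *_) (recS k)) (*-distribˡ-+ c (S (sucℤ k)) (S k))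

recurrent-*ʳ : ∀ c → Recurrent S → Recurrent (λ x → S x * c)
recurrent-*ʳ {S} c (recurrent recS) = recurrent λ k →
  trans (cong (_* c) (recS k)) (*-distribʳ-+ c (S (sucℤ k)) (S k))

recurrent-+ : Recurrent S → Recurrent T → Recurrent (λ x → S x + T x)
recurrent-+ {S} {T} (recurrent recS) (recurrent recT) = recurrent λ k →
  trans (cong₂ _+_ (recS k) (recT k)) (interchange (S (sucℤ k)) (S k) (T (sucℤ k)) (T k))

recurrent-agree : ∀ k → Recurrent S → Recurrent T → S k ≡ T k → S (sucℤ k) ≡ T (sucℤ k) →
                  ∀ x → S x ≡ T x
recurrent-agree {S} {T} k recS recT eₖ eₖ₊₁ x = begin
  S x            ≡⟨ cong S (minus-plus x k) ⟨
  S (x - k + k)  ≡⟨ recurrent-agree₀ (recurrent-translateʳ k recS) (recurrent-translateʳ k recT)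
                      (subst (λ y → S y ≡ T y) (sym (+-identityˡ k)) eₖ) eₖ₊₁ (x - k) ⟩
  T (x - k + k)  ≡⟨ cong T (minus-plus x k) ⟩
  T x            ∎
  where
  minus-plus : ∀ i j → i - j + j ≡ i
  minus-plus = solve-∀

fib-recurrent : Recurrent fib
fib-recurrent = recurrent λ
  { (+ n)                → refl
  ; -[1+ zero ]          → refl
  ; -[1+ suc zero ]      → refl
  ; -[1+ suc (suc j) ]   → alternating (signℕ j) (fibℕ (suc j)) (fibℕ j)
  }
  where
  alternating : ∀ s a b → s * a ≡ - s * (a + b) + - - s * (a + b + a)
  alternating = solve-∀

Gseq-recurrent : ∀ g₀ g₁ → Recurrent (Gseq g₀ g₁)
Gseq-recurrent g₀ g₁ = recurrent unfold
  where
  G : ℤ → ℤ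
  G = Gseq g₀ g₁

  x≡y+[x-y] : ∀ x y → x ≡ y + (x - y)
  x≡y+[x-y] = solve-∀

  backward-step : ∀ k → G (sucℤ (sucℤ k)) ≡ G (sucℤ k) + (G (sucℤ (sucℤ k)) - G (sucℤ k))
  backward-step k = x≡y+[x-y] (G (sucℤ (sucℤ k))) (G (sucℤ k))

  unfold : ∀ k → G (sucℤ (sucℤ k)) ≡ G (sucℤ k) + G k
  unfold (+ n)              = +-comm (proj₁ (Gpos g₀ g₁ n)) (proj₂ (Gpos g₀ g₁ n))
  -- Splitting off the first two negative indices lets G k compute to G (k + 2) - G (k + 1).
  unfold -[1+ zero ]        = backward-step -[1+ zero ]
  unfold -[1+ suc zero ]    = backward-step -[1+ suc zero ]
  unfold -[1+ suc (suc j) ] = backward-step -[1+ suc (suc j) ]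

signℕ-square : ∀ k → signℕ k * signℕ k ≡ 1ℤ
signℕ-square zero    = refl
signℕ-square (suc k) = begin
  - signℕ k * - signℕ k    ≡⟨ neg-distribˡ-* (signℕ k) (- signℕ k) ⟨
  - (signℕ k * - signℕ k)  ≡⟨ cong -_ (neg-distribʳ-* (signℕ k) (signℕ k)) ⟨
  - - (signℕ k * signℕ k)  ≡⟨ neg-involutive _ ⟩
  signℕ k * signℕ k        ≡⟨ signℕ-square k ⟩
  1ℤ                       ∎

signℤ-square : ∀ u → signℤ u * signℤ u ≡ 1ℤ
signℤ-square (+ n)    = signℕ-square n
signℤ-square -[1+ k ] = signℕ-square (suc k)

signℤ-suc : ∀ u → signℤ (sucℤ u) ≡ - signℤ u
signℤ-suc (+ n)          = refl
signℤ-suc -[1+ zero ]    = refl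
signℤ-suc -[1+ suc n ]   = sym (neg-involutive (signℕ (suc n)))

signℤ-+ : ∀ u v → signℤ (u + v) ≡ signℤ u * signℤ v
signℤ-+ u = ℤ-induction (λ v → signℤ (u + v) ≡ signℤ u * signℤ v)
  (trans (cong signℤ (+-identityʳ u)) (sym (*-identityʳ (signℤ u))))
  (λ v h → trans (sym (left v)) (trans (cong -_ h) (right v)))
  (λ v h → neg-injective (trans (left v) (trans h (sym (right v)))))
  where
  left : ∀ v → - signℤ (u + v) ≡ signℤ (u + sucℤ v)
  left v = sym (trans (cong signℤ (+-suc u v)) (signℤ-suc (u + v)))
  right : ∀ v → - (signℤ u * signℤ v) ≡ signℤ u * signℤ (sucℤ v)
  right v = trans (neg-distribʳ-* (signℤ u) (signℤ v)) (cong (signℤ u *_) (sym (signℤ-suc v)))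

signℤ-+-double : ∀ u v → signℤ (u + (v + v)) ≡ signℤ u
signℤ-+-double u v = begin
  signℤ (u + (v + v))       ≡⟨ signℤ-+ u (v + v) ⟩
  signℤ u * signℤ (v + v)   ≡⟨ cong (signℤ u *_) (trans (signℤ-+ v v) (signℤ-square v)) ⟩
  signℤ u * 1ℤ              ≡⟨ *-identityʳ (signℤ u) ⟩
  signℤ u                   ∎

fib-neg : ∀ x → fib (- x) ≡ signℤ (sucℤ x) * fib x
fib-neg (+ zero)    = refl
fib-neg (+ suc k)   = cong (_* fibℕ (suc k)) (sym (neg-involutive (signℕ k)))
fib-neg -[1+ k ]    = sym (begin
  signℤ (sucℤ -[1+ k ]) * (signℕ k * fibℕ (suc k))  ≡⟨ cong (_* (signℕ k * fibℕ (suc k)))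
                                                         (trans (signℤ-suc -[1+ k ]) (neg-involutive (signℕ k))) ⟩
  signℕ k * (signℕ k * fibℕ (suc k))                 ≡⟨ *-assoc (signℕ k) (signℕ k) (fibℕ (suc k)) ⟨
  signℕ k * signℕ k * fibℕ (suc k)                   ≡⟨ cong (_* fibℕ (suc k)) (signℕ-square k) ⟩
  1ℤ * fibℕ (suc k)                                  ≡⟨ *-identityˡ (fibℕ (suc k)) ⟩
  fibℕ (suc k)                                       ∎)

recurrent-expand : Recurrent S → ∀ k y → S (k + y) ≡ fib y * S (sucℤ k) + fib (pred y) * S k
recurrent-expand {S} recS k = recurrent-agree₀
  (recurrent-translateˡ k recS)
  (recurrent-+ (recurrent-*ʳ (S (sucℤ k)) fib-recurrent)
               (recurrent-*ʳ (S k) (recurrent-translateˡ -1ℤ fib-recurrent)))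
  (trans (cong S (+-identityʳ k)) (sym (trans (+-identityˡ (1ℤ * S k)) (*-identityˡ (S k)))))
  (trans (cong S (+-comm k 1ℤ)) (sym (trans (+-identityʳ (1ℤ * S (sucℤ k))) (*-identityˡ (S (sucℤ k))))))

sign-sum≡sign-difference : ∀ a b → signℤ (a + b + + 1) ≡ signℤ (sucℤ (a - b))
sign-sum≡sign-difference a b =
  trans (cong signℤ (regroup a b)) (signℤ-+-double (sucℤ (a - b)) b)
  where
  regroup : ∀ a b → a + b + + 1 ≡ + 1 + (a - b) + (b + b)
  regroup = solve-∀

fib-reflect : ∀ a b → signℤ (a + b + + 1) * fib (b - a) ≡ fib (a - b)
fib-reflect a b = begin
  signℤ (a + b + + 1) * fib (b - a)  ≡⟨ cong₂ (λ s y → s * fib y) (sign-sum≡sign-difference a b)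
                                          (sym (⁻¹-anti-homo‿- a b)) ⟩
  σ * fib (- x)                      ≡⟨ cong (σ *_) (fib-neg x) ⟩
  σ * (σ * fib x)                    ≡⟨ *-assoc σ σ (fib x) ⟨
  σ * σ * fib x                      ≡⟨ cong (_* fib x) (signℤ-square (sucℤ x)) ⟩
  1ℤ * fib x                         ≡⟨ *-identityˡ (fib x) ⟩
  fib x                              ∎
  where
  x = a - b
  σ = signℤ (sucℤ x)

fib-reflect-suc : ∀ a b → signℤ (a + b + + 1) * fib (sucℤ b - a) ≡ - fib (pred (a - b))
fib-reflect-suc a b = begin
  signℤ (a + b + + 1) * fib (sucℤ b - a)  ≡⟨ cong₂ (λ s y → s * fib y) (sign-sum≡sign-difference a b)
                                               (reflect a b) ⟩
  signℤ (sucℤ x) * fib (- pred x)          ≡⟨ cong₂ _*_ (signℤ-suc x) (fib-neg (pred x)) ⟩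
  - σ * (signℤ (sucℤ (pred x)) * fib p)    ≡⟨ cong (λ y → - σ * (signℤ y * fib p)) (suc-pred x) ⟩
  - σ * (σ * fib p)                        ≡⟨ neg-distribˡ-* σ (σ * fib p) ⟨
  - (σ * (σ * fib p))                      ≡⟨ cong -_ (*-assoc σ σ (fib p)) ⟨
  - (σ * σ * fib p)                        ≡⟨ cong (λ y → - (y * fib p)) (signℤ-square x) ⟩
  - (1ℤ * fib p)                           ≡⟨ cong -_ (*-identityˡ (fib p)) ⟩
  - fib p                                  ∎
  where
  x = a - b
  p = pred x
  σ = signℤ x
  reflect : ∀ a b → + 1 + b - a ≡ - (- + 1 + (a - b))
  reflect = solve-∀

recurrent-identity : Recurrent S → ∀ a b m →
  fib (a - b) * S m ≡ fib (m - b) * S a + signℤ (a + b + + 1) * fib (m - a) * S b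
recurrent-identity {S} recS a b = recurrent-agree b
  (recurrent-*ˡ (fib (a - b)) recS)
  (recurrent-+ (recurrent-*ʳ (S a) (recurrent-translateʳ (- b) fib-recurrent))
               (recurrent-*ʳ (S b) (recurrent-*ˡ s (recurrent-translateʳ (- a) fib-recurrent))))
  (sym at-b) (sym at-suc-b)
  where
  x = a - b
  s = signℤ (a + b + + 1)

  at-b : fib (b - b) * S a + s * fib (b - a) * S b ≡ fib x * S b
  at-b = begin
    fib (b - b) * S a + s * fib (b - a) * S b  ≡⟨ cong (λ y → fib y * S a + s * fib (b - a) * S b)
                                                    (+-inverseʳ b) ⟩
    0ℤ + s * fib (b - a) * S b                 ≡⟨ +-identityˡ (s * fib (b - a) * S b) ⟩
    s * fib (b - a) * S b                      ≡⟨ cong (_* S b) (fib-reflect a b) ⟩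
    fib x * S b                                ∎

  at-suc-b : fib (sucℤ b - b) * S a + s * fib (sucℤ b - a) * S b ≡ fib x * S (sucℤ b)
  at-suc-b = begin
    fib (sucℤ b - b) * S a + s * fib (sucℤ b - a) * S b
      ≡⟨ cong₂ (λ y t → fib y * S a + t * S b) (suc-minus b) (fib-reflect-suc a b) ⟩
    1ℤ * S a + - fib (pred x) * S b
      ≡⟨ cong (λ y → 1ℤ * S y + - fib (pred x) * S b) (plus-minus b a) ⟨
    1ℤ * S (b + x) + - fib (pred x) * S b
      ≡⟨ cong (λ y → 1ℤ * y + - fib (pred x) * S b) (recurrent-expand recS b x) ⟩
    1ℤ * (fib x * S (sucℤ b) + fib (pred x) * S b) + - fib (pred x) * S b
      ≡⟨ cancel (fib x * S (sucℤ b)) (fib (pred x)) (S b) ⟩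
    fib x * S (sucℤ b)
      ∎
    where
    suc-minus : ∀ b → + 1 + b - b ≡ + 1
    suc-minus = solve-∀
    plus-minus : ∀ b a → b + (a - b) ≡ a
    plus-minus = solve-∀
    cancel : ∀ u f t → + 1 * (u + f * t) + - f * t ≡ u
    cancel = solve-∀

-- The identity holds for every solution of the recurrence.
theorem1 : (g0 g1 : ℤ) → ¬ (g0 ≡ + 0 × g1 ≡ + 0) →
    (a b m n : ℤ) →
    fib (a - b) * Gseq g0 g1 (n + m)
      ≡ fib (m - b) * Gseq g0 g1 (n + a)
        + signℤ (a + b + + 1) * fib (m - a) * Gseq g0 g1 (n + b)
theorem1 g0 g1 _ a b m n =
  recurrent-identity (recurrent-translateˡ n (Gseq-recurrent g0 g1)) a b m
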